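{- For every $n\ge1$ there is a bijection between the set of heaps $H$ of size $n$ described in the context and the set of symmetric non-crossing perfect matchings on $n$ points.
   Context: **Heaps.** A heap (Viennot) is a finite poset with a labelling by pieces such that concurrent pieces are comparable and covering pieces are concurrent, up to isomorphism. The pieces here are monomers $[1,1]$ (a monomer can only be at abscissa $1$) and dimers $[c,c+1]$ with $c\ge1$. Two pieces are concurrent iff they intersect. The heaps considered have a unique maximal piece, and its left abscissa is $1$. The size of a heap with $N(d)$ dimers and $N(m)$ monomers is $2N(d)+N(m)$. **Symmetric matchings.** A symmetric non-crossing perfect matching on $n$ points is obtained by cutting a non-crossing perfect matching on $2n$ points along the vertical symmetry axis and keeping the left half. It consists of: - arches joining two of the $n$ points; - half-arches from a point to the right boundary. No two of these cross. Equivalently, it is a word $w_1\cdots w_n\in\{u,d\}^n$ in which every prefix has at least as many $u$'s as $d$'s. Each $d$ is matched with an earlier $u$ by the usual parenthesis matching, giving arches, and the unmatched $u$'s are the half-arches. -}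

module Defs where

open import Level using (0ℓ)
open import Data.Nat using (ℕ; zero; suc; _+_; _*_; _≤_)
open import Data.Fin using (Fin)
open import Data.List using (List; []; _∷_; _++_; length)
open import Data.Product using (Σ; ∃; ∃-syntax; _×_; _,_; proj₁)
open import Data.Sum using (_⊎_)
open import Relation.Binary.PropositionalEquality using (_≡_; _≢_)
open import Relation.Binary.Structures using (IsPartialOrder)
open import Function.Bundles using (_↔_; Inverse)

-- Pieces: the monomer [1,1] and dimers [c, c+1] with c ≥ 1.
-- `dimer c` stands for the dimer [c+1, c+2]  (so every c ≥ 1 is covered).

data Piece : Set where
  mono  : Piece
  dimer : ℕ → Piece

left : Piece → ℕ
left mono      = 1
left (dimer c) = suc c

right : Piece → ℕ
right mono      = 1
right (dimer c) = suc (suc c)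

Concurrent : Piece → Piece → Set
Concurrent p q = (left p ≤ right q) × (left q ≤ right p)

weight : Piece → ℕ
weight mono      = 1
weight (dimer _) = 2

sumFin : (k : ℕ) → (Fin k → ℕ) → ℕ
sumFin zero    f = 0
sumFin (suc k) f = f Fin.zero + sumFin k (λ i → f (Fin.suc i))

record Heap : Set₁ where
  field
    k    : ℕ
    lab  : Fin k → Piece
    _≼_  : Fin k → Fin k → Set
    isPO : IsPartialOrder _≡_ _≼_
    concurrent⇒comparable :
      ∀ x y → Concurrent (lab x) (lab y) → (x ≼ y) ⊎ (y ≼ x)
    covering⇒concurrent :
      ∀ x y → x ≼ y → x ≢ y →
      (∀ z → x ≼ z → z ≼ y → (z ≡ x) ⊎ (z ≡ y)) →
      Concurrent (lab x) (lab y)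
    top        : Fin k
    top-max    : ∀ y → top ≼ y → y ≡ top
    top-unique : ∀ m → (∀ y → m ≼ y → y ≡ m) → m ≡ top
    top-left   : left (lab top) ≡ 1

open Heap public

size : Heap → ℕ
size H = sumFin (k H) (λ i → weight (lab H i))

_≅_ : Heap → Heap → Set
H ≅ H' = Σ (Fin (k H) ↔ Fin (k H')) λ φ →
  (∀ x → lab H' (Inverse.to φ x) ≡ lab H x) ×
  (∀ x y → (_≼_ H x y → _≼_ H' (Inverse.to φ x) (Inverse.to φ y)) ×
           (_≼_ H' (Inverse.to φ x) (Inverse.to φ y) → _≼_ H x y))

HeapOfSize : ℕ → Set₁
HeapOfSize n = Σ Heap λ H → size H ≡ n

-- Symmetric non-crossing perfect matchings on n points, as words in
-- {u,d}^n every prefix of which has at least as many u's as d's.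

data Step : Set where
  u d : Step

#u : List Step → ℕ
#u []       = 0
#u (u ∷ w)  = suc (#u w)
#u (d ∷ w)  = #u w

#d : List Step → ℕ
#d []       = 0
#d (u ∷ w)  = #d w
#d (d ∷ w)  = suc (#d w)

IsSymMatching : ℕ → List Step → Set
IsSymMatching n w =
  (length w ≡ n) × (∀ p s → p ++ s ≡ w → #d p ≤ #u p)

SymMatching : ℕ → Set
SymMatching n = Σ (List Step) (IsSymMatching n)

{-# OPTIONS --safe #-}
module Submission where

-- Number the pieces by codes: the monomer is 0 and the dimer [c, c+1] is c. Two pieces meet
-- iff their codes differ by at most one.
--
-- Read from the right, a word w in {u,d}ⁿ assigns to each u the number c of d's to its right
-- that are still unmatched: the u is a half-arch, i.e. a monomer, if c = 0, and otherwise the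
-- left end of an arch, giving the dimer of code c. The prefix condition holds exactly when no
-- d is left unmatched, and the resulting code sequences t₁ … t_k are the canonical ones:
-- tᵢ ≤ tᵢ₊₁ + 1 and t_k ≤ 1, of total weight n.
--
-- A heap is recorded by repeatedly removing its minimal piece of least code. The next such piece
-- either covers the removed one, hence meets it, or was already minimal, so the codes form a
-- canonical sequence; conversely every canonical sequence stacks up to a heap with a unique
-- maximal piece touching abscissa 1. An isomorphism of heaps maps the minimal piece of least
-- code to the one of the other heap, so distinct sequences give non-isomorphic heaps.

open import Defs
  using ( Piece; mono; dimer; left; right; Concurrent; weight; sumFin; Heap; size; _≅_; HeapOfSize
        ; Step; u; d; #u; #d; IsSymMatching; SymMatching )
open import Level using (0ℓ)
import Algebra.Properties.CommutativeMonoid.Sum as CommutativeMonoidSum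
open import Data.Nat using (ℕ; zero; suc; pred; _+_; _∸_; _≤_; _<_; _≥_; z≤n; s≤s; s≤s⁻¹; _≤?_; _<?_)
open import Data.Nat.Properties
  using ( +-suc; +-identityʳ; ≤-refl; ≤-reflexive; ≤-trans; ≤-antisym; ≤-irrelevant; n≤1+n; m≤n⇒m≤1+n
        ; <-irrefl; <⇒≤; ≮⇒≥; ≰⇒>; pred-mono-≤; m∸n+n≡m; n≤0⇒n≡0; +-0-commutativeMonoid )
open import Data.Nat.ListAction using (sum)
open import Data.Nat.Induction using (<-wellFounded)
open import Data.List using (List; []; _∷_; _++_; length; foldr; foldl; reverse; replicate; map)
open import Data.List.Properties
  using (∷-injective; reverse-foldl; reverse-involutive; reverse-injective; length-reverse)
open import Data.Fin using (Fin; zero; suc; _≟_; punchIn; punchOut)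
open import Data.Fin.Properties
  using ( any?; all?; sequence; cantor-schröder-bernstein; suc-injective
        ; punchIn-punchOut; punchIn-injective; punchInᵢ≢i )
open import Data.Fin.Induction using (po-wellFounded; po-noetherian)
open import Data.Product using (Σ; ∃; _×_; _,_; proj₁; proj₂; swap)
open import Data.Sum using (_⊎_; inj₁; inj₂)
open import Data.Empty using (⊥; ⊥-elim)
open import Data.Unit using (⊤; tt)
open import Effect.Monad using (RawMonad)
open import Function using (_∘_; flip; case_of_)
open import Function.Bundles using (Inverse; mk↔ₛ′)
open import Induction.WellFounded using (Acc; acc)
open import Relation.Nullary using (¬_; Dec; yes; no; Irrelevant; contradiction)
open import Relation.Nullary.Decidable using (_×-dec_; _→-dec_; ¬?; map′; ¬¬-excluded-middle)
open import Relation.Nullary.Negation using (¬¬-Monad)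
open import Relation.Binary.Core using (Rel)
open import Relation.Binary.Definitions using (Decidable)
open import Relation.Binary.Structures using (IsPartialOrder)
open import Relation.Binary.PropositionalEquality
import Relation.Binary.Construct.NonStrictToStrict as ToStrict
import Relation.Binary.Construct.Flip.EqAndOrd as Flip
open import Relation.Binary.Construct.Closure.ReflexiveTransitive using (Star; ε; _◅_; _◅◅_)

code : Piece → ℕ
code mono      = 0
code (dimer c) = suc c

piece : ℕ → Piece
piece zero    = mono
piece (suc c) = dimer c

code-piece : ∀ t → code (piece t) ≡ t
code-piece zero    = refl
code-piece (suc t) = refl

piece-code : ∀ a → piece (code a) ≡ a
piece-code mono      = refl
piece-code (dimer c) = refl

piece-concurrent : ∀ {j t} → j ≤ suc t → t ≤ suc j → Concurrent (piece j) (piece t)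
piece-concurrent {zero}  {zero}  _  _  = s≤s z≤n , s≤s z≤n
piece-concurrent {zero}  {suc t} _  h₂ = s≤s z≤n , h₂
piece-concurrent {suc j} {zero}  h₁ _  = h₁ , s≤s z≤n
piece-concurrent {suc j} {suc t} h₁ h₂ = h₁ , h₂

concurrent⇒code≤ : ∀ a b → Concurrent a b → code a ≤ suc (code b)
concurrent⇒code≤ mono      _         _       = z≤n
concurrent⇒code≤ (dimer c) mono      (h , _) = h
concurrent⇒code≤ (dimer c) (dimer e) (h , _) = h

concurrent-refl : ∀ a → Concurrent a a
concurrent-refl mono      = s≤s z≤n , s≤s z≤n
concurrent-refl (dimer c) = n≤1+n _ , n≤1+n _

concurrent? : ∀ a b → Dec (Concurrent a b)
concurrent? a b = (left a ≤? right b) ×-dec (left b ≤? right a)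

left≡1⇒code≤1 : ∀ a → left a ≡ 1 → code a ≤ 1
left≡1⇒code≤1 mono          _ = z≤n
left≡1⇒code≤1 (dimer zero)  _ = s≤s z≤n

code≤1⇒left≡1 : ∀ {t} → t ≤ 1 → left (piece t) ≡ 1
code≤1⇒left≡1 z≤n       = refl
code≤1⇒left≡1 (s≤s z≤n) = refl

-- Canonical code sequences and symmetric matchings

weightSum : List ℕ → ℕ
weightSum = sum ∘ map (weight ∘ piece)

Fits : ℕ → List ℕ → Set
Fits b []      = b ≤ 1
Fits b (t ∷ p) = b ≤ suc t × Fits t p

Canonical : List ℕ → Set
Canonical []      = ⊥
Canonical (t ∷ p) = Fits t p

fits-irrelevant : ∀ b p → Irrelevant (Fits b p)
fits-irrelevant b []      = ≤-irrelevant
fits-irrelevant b (t ∷ p) (h , f) (h′ , f′) = cong₂ _,_ (≤-irrelevant h h′) (fits-irrelevant t p f f′)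

canonical-irrelevant : ∀ p → Irrelevant (Canonical p)
canonical-irrelevant (t ∷ p) = fits-irrelevant t p

m≤suc[pred[m]] : ∀ m → m ≤ suc (pred m)
m≤suc[pred[m]] zero    = z≤n
m≤suc[pred[m]] (suc m) = ≤-refl

tally : Step → ℕ → ℕ
tally u c = pred c
tally d c = suc c

unmatched : List Step → ℕ
unmatched = foldr tally 0

BalancedAbove : ℕ → List Step → Set
BalancedAbove k w = ∀ p s → p ++ s ≡ w → #d p ≤ k + #u p

balanced⇒unmatched≤ : ∀ k w → BalancedAbove k w → unmatched w ≤ k
balanced⇒unmatched≤ k       []      _ = z≤n
balanced⇒unmatched≤ k       (u ∷ w) b = pred-mono-≤ (balanced⇒unmatched≤ (suc k) w b′)
  where
  b′ : BalancedAbove (suc k) w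
  b′ p s refl = subst (#d p ≤_) (+-suc k (#u p)) (b (u ∷ p) s refl)
balanced⇒unmatched≤ zero    (d ∷ w) b with () ← b (d ∷ []) w refl
balanced⇒unmatched≤ (suc k) (d ∷ w) b =
  s≤s (balanced⇒unmatched≤ k w λ p s e → s≤s⁻¹ (b (d ∷ p) s (cong (d ∷_) e)))

unmatched≤⇒balanced : ∀ k w → unmatched w ≤ k → BalancedAbove k w
unmatched≤⇒balanced k       w       _       []      s _    = z≤n
unmatched≤⇒balanced k       (u ∷ w) h       (u ∷ p) s refl =
  subst (#d p ≤_) (sym (+-suc k (#u p))) (unmatched≤⇒balanced (suc k) w w≤1+k p s refl)
  where
  w≤1+k : unmatched w ≤ suc k
  w≤1+k = ≤-trans (m≤suc[pred[m]] (unmatched w)) (s≤s h)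
unmatched≤⇒balanced (suc k) (d ∷ w) (s≤s h) (d ∷ p) s refl =
  s≤s (unmatched≤⇒balanced k w h p s refl)

scanCodes : ℕ → List Step → List ℕ
scanCodes c []      = []
scanCodes c (u ∷ r) = c ∷ scanCodes (pred c) r
scanCodes c (d ∷ r) = scanCodes (suc c) r

residue : ℕ → List Step → ℕ
residue = foldl (flip tally)

length+c≡weightSum+residue : ∀ c r → length r + c ≡ weightSum (scanCodes c r) + residue c r
length+c≡weightSum+residue c       []      = refl
length+c≡weightSum+residue zero    (u ∷ r) = cong suc (length+c≡weightSum+residue 0 r)
length+c≡weightSum+residue (suc c) (u ∷ r) = begin
  suc (length r + suc c)    ≡⟨ cong suc (+-suc (length r) c) ⟩
  suc (suc (length r + c))  ≡⟨ cong (2 +_) (length+c≡weightSum+residue c r) ⟩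
  suc (suc (weightSum (scanCodes c r) + residue c r)) ∎
  where open ≡-Reasoning
length+c≡weightSum+residue c       (d ∷ r) =
  trans (sym (+-suc (length r) c)) (length+c≡weightSum+residue (suc c) r)

scanCodes-fits : ∀ {b} c r → b ≤ suc c → residue c r ≡ 0 → Fits b (scanCodes c r)
scanCodes-fits c (u ∷ r) b≤1+c res≡0 = b≤1+c , scanCodes-fits (pred c) r (m≤suc[pred[m]] c) res≡0
scanCodes-fits c (d ∷ r) b≤1+c res≡0 = scanCodes-fits (suc c) r (m≤n⇒m≤1+n b≤1+c) res≡0
scanCodes-fits c []      b≤1+c refl  = b≤1+c

scanCodes-head : ∀ c r {t q} → scanCodes c r ≡ t ∷ q → c ≤ t
scanCodes-head c (u ∷ r) refl = ≤-refl
scanCodes-head c (d ∷ r) e    = ≤-trans (n≤1+n c) (scanCodes-head (suc c) r e)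

scanCodes-[] : ∀ c r → scanCodes c r ≡ [] → c ≤ residue c r
scanCodes-[] c []      _ = ≤-refl
scanCodes-[] c (d ∷ r) e = ≤-trans (n≤1+n c) (scanCodes-[] (suc c) r e)

scanCodes-injective : ∀ c r r′ → scanCodes c r ≡ scanCodes c r′ → residue c r ≡ residue c r′ →
                      r ≡ r′
scanCodes-injective c []      []       _ _ = refl
scanCodes-injective c (u ∷ r) (u ∷ r′) e f =
  cong (u ∷_) (scanCodes-injective (pred c) r r′ (proj₂ (∷-injective e)) f)
scanCodes-injective c (d ∷ r) (d ∷ r′) e f = cong (d ∷_) (scanCodes-injective (suc c) r r′ e f)
scanCodes-injective c []      (d ∷ r′) e f = ⊥-elim (<-irrefl f (scanCodes-[] (suc c) r′ (sym e)))
scanCodes-injective c (d ∷ r) []       e f = ⊥-elim (<-irrefl (sym f) (scanCodes-[] (suc c) r e))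
scanCodes-injective c (u ∷ r) (d ∷ r′) e f = ⊥-elim (<-irrefl refl (scanCodes-head (suc c) r′ (sym e)))
scanCodes-injective c (d ∷ r) (u ∷ r′) e f = ⊥-elim (<-irrefl refl (scanCodes-head (suc c) r e))

spell : ℕ → List ℕ → List Step
spell c []      = []
spell c (t ∷ p) = replicate (t ∸ c) d ++ u ∷ spell (pred t) p

scanCodes-ds : ∀ j c r → scanCodes c (replicate j d ++ r) ≡ scanCodes (j + c) r
scanCodes-ds zero    c r = refl
scanCodes-ds (suc j) c r =
  trans (scanCodes-ds j (suc c) r) (cong (λ c′ → scanCodes c′ r) (+-suc j c))

residue-ds : ∀ j c r → residue c (replicate j d ++ r) ≡ residue (j + c) r
residue-ds zero    c r = refl
residue-ds (suc j) c r =
  trans (residue-ds j (suc c) r) (cong (λ c′ → residue c′ r) (+-suc j c))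

scanCodes-spell : ∀ b p → Fits b p → scanCodes (pred b) (spell (pred b) p) ≡ p
scanCodes-spell b []      _ = refl
scanCodes-spell b (t ∷ p) (b≤1+t , fits) = begin
  scanCodes (pred b) (replicate (t ∸ pred b) d ++ u ∷ spell (pred t) p)
    ≡⟨ scanCodes-ds (t ∸ pred b) (pred b) _ ⟩
  scanCodes (t ∸ pred b + pred b) (u ∷ spell (pred t) p)
    ≡⟨ cong (λ c → scanCodes c (u ∷ spell (pred t) p)) (m∸n+n≡m (pred-mono-≤ b≤1+t)) ⟩
  t ∷ scanCodes (pred t) (spell (pred t) p)
    ≡⟨ cong (t ∷_) (scanCodes-spell t p fits) ⟩
  t ∷ p
    ∎
  where open ≡-Reasoning

residue-spell : ∀ b p → Fits b p → residue (pred b) (spell (pred b) p) ≡ 0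
residue-spell b []      b≤1 = n≤0⇒n≡0 (pred-mono-≤ b≤1)
residue-spell b (t ∷ p) (b≤1+t , fits) = begin
  residue (pred b) (replicate (t ∸ pred b) d ++ u ∷ spell (pred t) p)
    ≡⟨ residue-ds (t ∸ pred b) (pred b) _ ⟩
  residue (t ∸ pred b + pred b) (u ∷ spell (pred t) p)
    ≡⟨ cong (λ c → residue c (u ∷ spell (pred t) p)) (m∸n+n≡m (pred-mono-≤ b≤1+t)) ⟩
  residue (pred t) (spell (pred t) p)
    ≡⟨ residue-spell t p fits ⟩
  0
    ∎
  where open ≡-Reasoning

codesOf : List Step → List ℕ
codesOf w = scanCodes 0 (reverse w)

residue-reverse : ∀ w → residue 0 (reverse w) ≡ unmatched w
residue-reverse = reverse-foldl (flip tally) 0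

module _ {n w} (m : IsSymMatching n w) where

  residue≡0 : residue 0 (reverse w) ≡ 0
  residue≡0 = trans (residue-reverse w) (n≤0⇒n≡0 (balanced⇒unmatched≤ 0 w (proj₂ m)))

  weightSum-codesOf : weightSum (codesOf w) ≡ n
  weightSum-codesOf = begin
    weightSum (codesOf w)                         ≡⟨ sym (+-identityʳ _) ⟩
    weightSum (codesOf w) + 0                     ≡⟨ cong (weightSum (codesOf w) +_) (sym residue≡0) ⟩
    weightSum (codesOf w) + residue 0 (reverse w) ≡⟨ sym (length+c≡weightSum+residue 0 (reverse w)) ⟩
    length (reverse w) + 0                        ≡⟨ +-identityʳ _ ⟩
    length (reverse w)                            ≡⟨ length-reverse w ⟩
    length w                                      ≡⟨ proj₁ m ⟩
    n                                             ∎
    where open ≡-Reasoning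

  codesOf-canonical : 1 ≤ n → Canonical (codesOf w)
  codesOf-canonical 1≤n
    with codesOf w | scanCodes-fits {0} 0 (reverse w) z≤n residue≡0 | weightSum-codesOf
  ... | []    | _        | 0≡n = ⊥-elim (<-irrefl 0≡n 1≤n)
  ... | t ∷ q | _ , fits | _   = fits

codesOf-injective : ∀ {n w w′} → IsSymMatching n w → IsSymMatching n w′ →
                    codesOf w ≡ codesOf w′ → w ≡ w′
codesOf-injective {w = w} {w′} m m′ e = reverse-injective
  (scanCodes-injective 0 (reverse w) (reverse w′) e (trans (residue≡0 m) (sym (residue≡0 m′))))

codesOf-surjective : ∀ p → Canonical p → ∃ λ w → IsSymMatching (weightSum p) w × codesOf w ≡ p
codesOf-surjective (t ∷ p) fits =
  reverse r , (length≡ , balanced) , trans (cong (scanCodes 0) (reverse-involutive r)) codes≡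
  where
  r = spell 0 (t ∷ p)
  fits₁ : Fits 1 (t ∷ p)
  fits₁ = s≤s z≤n , fits
  res≡0 : residue 0 r ≡ 0
  res≡0 = residue-spell 1 (t ∷ p) fits₁
  codes≡ : scanCodes 0 r ≡ t ∷ p
  codes≡ = scanCodes-spell 1 (t ∷ p) fits₁
  length≡ : length (reverse r) ≡ weightSum (t ∷ p)
  length≡ = begin
    length (reverse r)                        ≡⟨ length-reverse r ⟩
    length r                                  ≡⟨ sym (+-identityʳ _) ⟩
    length r + 0                              ≡⟨ length+c≡weightSum+residue 0 r ⟩
    weightSum (scanCodes 0 r) + residue 0 r   ≡⟨ cong₂ _+_ (cong weightSum codes≡) res≡0 ⟩
    weightSum (t ∷ p) + 0                     ≡⟨ +-identityʳ _ ⟩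
    weightSum (t ∷ p)                         ∎
    where open ≡-Reasoning
  balanced : BalancedAbove 0 (reverse r)
  balanced = unmatched≤⇒balanced 0 (reverse r) (≤-reflexive (begin
    unmatched (reverse r)         ≡⟨ sym (residue-reverse (reverse r)) ⟩
    residue 0 (reverse (reverse r)) ≡⟨ cong (residue 0) (reverse-involutive r) ⟩
    residue 0 r                   ≡⟨ res≡0 ⟩
    0                             ∎))
    where open ≡-Reasoning

-- Finite posets

argmin : ∀ {n} {P : Fin n → Set} (f : Fin n → ℕ) → (∀ x → Dec (P x)) → ∃ P →
         ∃ λ x → P x × ∀ y → P y → f x ≤ f y
argmin {P = P} f P? (x₀ , Px₀) = go x₀ Px₀ (<-wellFounded (f x₀))
  where
  go : ∀ x → P x → Acc _<_ (f x) → ∃ λ x → P x × ∀ y → P y → f x ≤ f y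
  go x Px (acc rec) with any? (λ y → P? y ×-dec f y <? f x)
  ... | yes (y , Py , fy<fx) = go y Py (rec fy<fx)
  ... | no ∄ = x , Px , λ y Py → ≮⇒≥ λ fy<fx → ∄ (y , Py , fy<fx)

module FinitePoset {n} {_≼_ : Rel (Fin n) 0ℓ} (isPO : IsPartialOrder _≡_ _≼_) where
  open IsPartialOrder isPO using () renaming (refl to ≼-refl; trans to ≼-trans)

  _≺_ : Rel (Fin n) 0ℓ
  _≺_ = ToStrict._<_ _≡_ _≼_

  MaximalIn : (Fin n → Set) → Fin n → Set
  MaximalIn P m = P m × ∀ z → P z → m ≼ z → z ≡ m

  module _ (_≼?_ : Decidable _≼_) where

    maximal-above : ∀ {P} → (∀ z → Dec (P z)) → ∀ {x} → P x → ∃ λ m → x ≼ m × MaximalIn P m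
    maximal-above {P} P? {x} Px = go x Px (po-noetherian isPO x)
      where
      go : ∀ y → P y → Acc (flip _≺_) y → ∃ λ m → y ≼ m × MaximalIn P m
      go y Py (acc rec) with any? (λ z → P? z ×-dec ToStrict.<-decidable _≡_ _≼_ _≟_ _≼?_ y z)
      ... | yes (z , Pz , y≺z) =
        let m , z≼m , max = go z Pz (rec y≺z) in m , ≼-trans (proj₁ y≺z) z≼m , max
      ... | no ∄ = y , ≼-refl , Py , maximal
        where
        maximal : ∀ z → P z → y ≼ z → z ≡ y
        maximal z Pz y≼z with z ≟ y
        ... | yes z≡y = z≡y
        ... | no z≢y  = contradiction (z , Pz , y≼z , z≢y ∘ sym) ∄

record HeapOn (n : ℕ) : Set₁ where
  field
    lab : Fin n → Piece
    _≼_ : Fin n → Fin n → Set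
    isPO : IsPartialOrder _≡_ _≼_
    concurrent⇒comparable : ∀ x y → Concurrent (lab x) (lab y) → (x ≼ y) ⊎ (y ≼ x)
    covering⇒concurrent :
      ∀ x y → x ≼ y → x ≢ y →
      (∀ z → x ≼ z → z ≼ y → (z ≡ x) ⊎ (z ≡ y)) →
      Concurrent (lab x) (lab y)
    top        : Fin n
    top-max    : ∀ y → top ≼ y → y ≡ top
    top-unique : ∀ m → (∀ y → m ≼ y → y ≡ m) → m ≡ top
    top-left   : left (lab top) ≡ 1

  Minimal : Fin n → Set
  Minimal x = ∀ y → y ≼ x → y ≡ x

toHeap : ∀ {n} → HeapOn n → Heap
toHeap {n} G = record
  { k = n ; lab = lab ; _≼_ = _≼_ ; isPO = isPO
  ; concurrent⇒comparable = concurrent⇒comparable ; covering⇒concurrent = covering⇒concurrent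
  ; top = top ; top-max = top-max ; top-unique = top-unique ; top-left = top-left }
  where open HeapOn G

fromHeap : (H : Heap) → HeapOn (Heap.k H)
fromHeap H = record
  { lab = lab ; _≼_ = _≼_ ; isPO = isPO
  ; concurrent⇒comparable = concurrent⇒comparable ; covering⇒concurrent = covering⇒concurrent
  ; top = top ; top-max = top-max ; top-unique = top-unique ; top-left = top-left }
  where open Heap H

module HeapOrder {n} (G : HeapOn n) where
  open HeapOn G
  open IsPartialOrder isPO using () renaming (refl to ≼-refl; trans to ≼-trans; antisym to ≼-antisym)
  open FinitePoset isPO using (_≺_; maximal-above)
  private module Dual = FinitePoset (Flip.isPartialOrder isPO)

  _↗_ : Rel (Fin n) 0ℓ
  x ↗ y = Concurrent (lab x) (lab y) × x ≺ y

  _↗*_ : Rel (Fin n) 0ℓ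
  _↗*_ = Star _↗_

  ↗*⇒≼ : ∀ {x y} → x ↗* y → x ≼ y
  ↗*⇒≼ ε                      = ≼-refl
  ↗*⇒≼ ((_ , x≼c , _) ◅ c↗*y) = ≼-trans x≼c (↗*⇒≼ c↗*y)

  _↗?_ : Decidable _↗_
  x ↗? y with concurrent? (lab x) (lab y)
  ... | no ¬c = no (¬c ∘ proj₁)
  ... | yes c with x ≟ y | concurrent⇒comparable x y c
  ...   | yes refl | _        = no λ (_ , _ , x≢x) → x≢x refl
  ...   | no x≢y   | inj₁ x≼y = yes (c , x≼y , x≢y)
  ...   | no x≢y   | inj₂ y≼x = no λ (_ , x≼y , _) → x≢y (≼-antisym x≼y y≼x)

  _↗*?_ : Decidable _↗*_
  x ↗*? y = go x (po-noetherian isPO x)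
    where
    go : ∀ x → Acc (flip _≺_) x → Dec (x ↗* y)
    go x (acc rec) with x ≟ y
    ... | yes refl = yes ε
    ... | no x≢y   = map′ (λ (c , x↗c , c↗*y) → x↗c ◅ c↗*y) uncons (any? step)
      where
      step : ∀ c → Dec (x ↗ c × c ↗* y)
      step c with x ↗? c
      ... | yes x↗c = map′ (x↗c ,_) proj₂ (go c (rec (proj₂ x↗c)))
      ... | no ¬x↗c = no (¬x↗c ∘ proj₁)
      uncons : x ↗* y → ∃ λ c → x ↗ c × c ↗* y
      uncons ε            = contradiction refl x≢y
      uncons (x↗c ◅ c↗*y) = _ , x↗c , c↗*y

  ≼⇒↗* : Decidable _≼_ → ∀ {x y} → x ≼ y → x ↗* y
  ≼⇒↗* _≼?_ {x} {y} x≼y = go y (po-wellFounded isPO y) x≼y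
    where
    go : ∀ y → Acc _≺_ y → x ≼ y → x ↗* y
    go y (acc rec) x≼y with x ≟ y
    ... | yes refl = ε
    ... | no x≢y
      with maximal-above _≼?_ (λ z → (x ≼? z) ×-dec ((z ≼? y) ×-dec ¬? (z ≟ y))) (≼-refl , x≼y , x≢y)
    ...   | w , x≼w , (_ , w≼y , w≢y) , maximal = go w (rec (w≼y , w≢y)) x≼w ◅◅ (w↗y ◅ ε)
      where
      covers : ∀ z → w ≼ z → z ≼ y → (z ≡ w) ⊎ (z ≡ y)
      covers z w≼z z≼y with z ≟ y
      ... | yes z≡y = inj₂ z≡y
      ... | no z≢y  = inj₁ (maximal z (≼-trans x≼w w≼z , z≼y , z≢y) w≼z)
      w↗y : w ↗ y
      w↗y = covering⇒concurrent w y w≼y w≢y covers , w≼y , w≢y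

  ¬¬-decidable : ¬ ¬ Decidable _≼_
  ¬¬-decidable = ¬¬-sequence λ x → ¬¬-sequence λ y → ¬¬-excluded-middle
    where
    ¬¬-sequence : ∀ {P : Fin n → Set} → (∀ i → ¬ ¬ P i) → ¬ ¬ (∀ i → P i)
    ¬¬-sequence = sequence (RawMonad.rawApplicative ¬¬-Monad)

  -- ≼ is generated by the decidable relation ↗, hence decidable. Proving that it is generated
  -- uses decidability of ≼, but ¬ x ≼ y is negative, so ¬ ¬ Decidable _≼_ suffices.
  _≼?_ : Decidable _≼_
  x ≼? y with x ↗*? y
  ... | yes x↗*y = yes (↗*⇒≼ x↗*y)
  ... | no ¬x↗*y = no λ x≼y → ¬¬-decidable λ _≼?′_ → ¬x↗*y (≼⇒↗* _≼?′_ x≼y)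

  first-step : ∀ {x y} → x ≺ y → ∃ λ c → x ↗ c × c ≼ y
  first-step (x≼y , x≢y) with ≼⇒↗* _≼?_ x≼y
  ... | ε          = contradiction refl x≢y
  ... | x↗c ◅ c↗*y = _ , x↗c , ↗*⇒≼ c↗*y

  ≼-top : ∀ y → y ≼ top
  ≼-top y with maximal-above _≼?_ {P = λ _ → ⊤} (λ _ → yes tt) tt
  ... | m , y≼m , _ , maximal = subst (y ≼_) (top-unique m λ z m≼z → maximal z tt m≼z) y≼m

  minimal-below : ∀ y → ∃ λ x → x ≼ y × Minimal x
  minimal-below y with Dual.maximal-above (flip _≼?_) {P = λ _ → ⊤} (λ _ → yes tt) tt
  ... | x , x≼y , _ , maximal = x , x≼y , λ z z≼x → maximal z tt z≼x

  minimal? : ∀ x → Dec (Minimal x)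
  minimal? x = all? λ y → (y ≼? x) →-dec (y ≟ x)

  minimal-concurrent⇒≡ : ∀ {x y} → Minimal x → Minimal y → Concurrent (lab x) (lab y) → x ≡ y
  minimal-concurrent⇒≡ {x} {y} min-x min-y c with concurrent⇒comparable x y c
  ... | inj₁ x≼y = min-y x x≼y
  ... | inj₂ y≼x = sym (min-x y y≼x)

  least-code-minimal : ∃ λ x → Minimal x × ∀ y → Minimal y → code (lab x) ≤ code (lab y)
  least-code-minimal with minimal-below top
  ... | x₀ , _ , min₀ = argmin (code ∘ lab) minimal? (x₀ , min₀)

record _≃_ {m n} (G : HeapOn m) (G′ : HeapOn n) : Set where
  private
    module G  = HeapOn G
    module G′ = HeapOn G′
  field
    to         : Fin m → Fin n
    from       : Fin n → Fin m
    to-from    : ∀ y → to (from y) ≡ y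
    from-to    : ∀ x → from (to x) ≡ x
    lab-to     : ∀ x → G′.lab (to x) ≡ G.lab x
    to-mono    : ∀ {x y} → x G.≼ y → to x G′.≼ to y
    to-reflect : ∀ {x y} → to x G′.≼ to y → x G.≼ y

  to-injective : ∀ {x y} → to x ≡ to y → x ≡ y
  to-injective {x} {y} e = trans (sym (from-to x)) (trans (cong from e) (from-to y))

  from-injective : ∀ {x y} → from x ≡ from y → x ≡ y
  from-injective {x} {y} e = trans (sym (to-from x)) (trans (cong to e) (to-from y))

  lab-from : ∀ y → G.lab (from y) ≡ G′.lab y
  lab-from y = trans (sym (lab-to (from y))) (cong G′.lab (to-from y))

  from-mono : ∀ {x y} → x G′.≼ y → from x G.≼ from y
  from-mono {x} {y} x≼y = to-reflect (subst₂ G′._≼_ (sym (to-from x)) (sym (to-from y)) x≼y)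

  from-reflect : ∀ {x y} → from x G.≼ from y → x G′.≼ y
  from-reflect {x} {y} x≼y = subst₂ G′._≼_ (to-from x) (to-from y) (to-mono x≼y)

  to-minimal : ∀ {x} → G.Minimal x → G′.Minimal (to x)
  to-minimal {x} min y y≼x =
    trans (sym (to-from y)) (cong to (min (from y) (subst (from y G.≼_) (from-to x) (from-mono y≼x))))

  from-minimal : ∀ {y} → G′.Minimal y → G.Minimal (from y)
  from-minimal {y} min x x≼y =
    trans (sym (from-to x)) (cong from (min (to x) (subst (to x G′.≼_) (to-from y) (to-mono x≼y))))

module _ {m n} {G : HeapOn m} {G′ : HeapOn n} where

  ≃⇒≅ : G ≃ G′ → toHeap G ≅ toHeap G′
  ≃⇒≅ I = mk↔ₛ′ to from to-from from-to , lab-to , λ _ _ → to-mono , to-reflect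
    where open _≃_ I

  ≅⇒≃ : toHeap G ≅ toHeap G′ → G ≃ G′
  ≅⇒≃ (φ , lab-to , order) = record
    { to = Inverse.to φ ; from = Inverse.from φ
    ; to-from = Inverse.strictlyInverseˡ φ ; from-to = Inverse.strictlyInverseʳ φ
    ; lab-to = lab-to
    ; to-mono = λ {x} {y} → proj₁ (order x y) ; to-reflect = λ {x} {y} → proj₂ (order x y) }

≃-refl : ∀ {n} {G : HeapOn n} → G ≃ G
≃-refl = record
  { to = λ x → x ; from = λ x → x ; to-from = λ _ → refl ; from-to = λ _ → refl
  ; lab-to = λ _ → refl ; to-mono = λ x≼y → x≼y ; to-reflect = λ x≼y → x≼y }

≃-sym : ∀ {m n} {G : HeapOn m} {G′ : HeapOn n} → G ≃ G′ → G′ ≃ G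
≃-sym I = record
  { to = from ; from = to ; to-from = from-to ; from-to = to-from
  ; lab-to = lab-from ; to-mono = from-mono ; to-reflect = from-reflect }
  where open _≃_ I

≃-trans : ∀ {m n o} {G : HeapOn m} {G′ : HeapOn n} {G″ : HeapOn o} → G ≃ G′ → G′ ≃ G″ → G ≃ G″
≃-trans I J = record
  { to = J.to ∘ I.to ; from = I.from ∘ J.from
  ; to-from = λ z → trans (cong J.to (I.to-from (J.from z))) (J.to-from z)
  ; from-to = λ x → trans (cong I.from (J.from-to (I.to x))) (I.from-to x)
  ; lab-to = λ x → trans (J.lab-to (I.to x)) (I.lab-to x)
  ; to-mono = J.to-mono ∘ I.to-mono ; to-reflect = I.to-reflect ∘ J.to-reflect }
  where
  module I = _≃_ I
  module J = _≃_ J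

≃⇒≡ : ∀ {m n} {G : HeapOn m} {G′ : HeapOn n} → G ≃ G′ → m ≡ n
≃⇒≡ I = cantor-schröder-bernstein to-injective from-injective
  where open _≃_ I

Fin1-all-zero : (x : Fin 1) → x ≡ zero
Fin1-all-zero zero = refl

singleton : (a : Piece) → left a ≡ 1 → HeapOn 1
singleton a a-left = record
  { lab = λ _ → a ; _≼_ = λ _ _ → ⊤
  ; isPO = record
    { isPreorder = record { isEquivalence = isEquivalence ; reflexive = λ _ → tt ; trans = λ _ _ → tt }
    ; antisym = λ {x} {y} _ _ → trans (Fin1-all-zero x) (sym (Fin1-all-zero y)) }
  ; concurrent⇒comparable = λ _ _ _ → inj₁ tt
  ; covering⇒concurrent = λ x y _ x≢y _ →
      contradiction (trans (Fin1-all-zero x) (sym (Fin1-all-zero y))) x≢y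
  ; top = zero ; top-max = λ y _ → Fin1-all-zero y ; top-unique = λ m _ → Fin1-all-zero m
  ; top-left = a-left }

module _ {n} (a : Piece) (G : HeapOn n) where
  open HeapOn G
  open IsPartialOrder isPO using () renaming (refl to ≼-refl; trans to ≼-trans; antisym to ≼-antisym)

  lab⁺ : Fin (suc n) → Piece
  lab⁺ zero    = a
  lab⁺ (suc i) = lab i

  _≼⁺_ : Fin (suc n) → Fin (suc n) → Set
  zero  ≼⁺ zero  = ⊤
  zero  ≼⁺ suc j = ∃ λ i → Concurrent a (lab i) × i ≼ j
  suc i ≼⁺ zero  = ⊥
  suc i ≼⁺ suc j = i ≼ j

  private
    ≼⁺-refl : ∀ {x} → x ≼⁺ x
    ≼⁺-refl {zero}  = tt
    ≼⁺-refl {suc i} = ≼-refl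

    ≼⁺-trans : ∀ {x y z} → x ≼⁺ y → y ≼⁺ z → x ≼⁺ z
    ≼⁺-trans {zero}  {zero}  {z}     _               y≼z = y≼z
    ≼⁺-trans {zero}  {suc j} {suc l} (i , c , i≼j)   j≼l = i , c , ≼-trans i≼j j≼l
    ≼⁺-trans {suc i} {suc j} {suc l} i≼j             j≼l = ≼-trans i≼j j≼l

    ≼⁺-antisym : ∀ {x y} → x ≼⁺ y → y ≼⁺ x → x ≡ y
    ≼⁺-antisym {zero}  {zero}  _   _   = refl
    ≼⁺-antisym {suc i} {suc j} i≼j j≼i = cong suc (≼-antisym i≼j j≼i)

    comparable⁺ : ∀ x y → Concurrent (lab⁺ x) (lab⁺ y) → (x ≼⁺ y) ⊎ (y ≼⁺ x)
    comparable⁺ zero    zero    _ = inj₁ tt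
    comparable⁺ zero    (suc j) c = inj₁ (j , c , ≼-refl)
    comparable⁺ (suc i) zero    c = inj₂ (i , swap c , ≼-refl)
    comparable⁺ (suc i) (suc j) c = concurrent⇒comparable i j c

    covering⁺ : ∀ x y → x ≼⁺ y → x ≢ y → (∀ z → x ≼⁺ z → z ≼⁺ y → (z ≡ x) ⊎ (z ≡ y)) →
                Concurrent (lab⁺ x) (lab⁺ y)
    covering⁺ zero    zero    _             x≢y _      = contradiction refl x≢y
    covering⁺ zero    (suc j) (i , c , i≼j) _   covers with covers (suc i) (i , c , ≼-refl) i≼j
    ... | inj₂ refl = c
    covering⁺ (suc i) (suc j) i≼j           i≢j covers =
      covering⇒concurrent i j i≼j (i≢j ∘ cong suc) covers′
      where
      covers′ : ∀ z → i ≼ z → z ≼ j → (z ≡ i) ⊎ (z ≡ j)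
      covers′ z i≼z z≼j with covers (suc z) i≼z z≼j
      ... | inj₁ e = inj₁ (suc-injective e)
      ... | inj₂ e = inj₂ (suc-injective e)

  -- a is added underneath G as the piece zero; the witness keeps it from being maximal.
  addBelow : (∃ λ i → Concurrent a (lab i)) → HeapOn (suc n)
  addBelow (i , c) = record
    { lab = lab⁺ ; _≼_ = _≼⁺_
    ; isPO = record
      { isPreorder = record
        { isEquivalence = isEquivalence
        ; reflexive = λ { {x} refl → ≼⁺-refl {x} }
        ; trans = λ {x} {y} {z} → ≼⁺-trans {x} {y} {z} }
      ; antisym = λ {x} {y} → ≼⁺-antisym {x} {y} }
    ; concurrent⇒comparable = comparable⁺
    ; covering⇒concurrent = covering⁺
    ; top = suc top
    ; top-max = λ { (suc y) top≼y → cong suc (top-max y top≼y) }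
    ; top-unique = λ
      { zero    maximal → case maximal (suc i) (i , c , ≼-refl) of λ ()
      ; (suc m) maximal → cong suc (top-unique m λ y m≼y → suc-injective (maximal (suc y) m≼y)) }
    ; top-left = top-left }

addBelow-cong : ∀ {m n a a′} {G : HeapOn m} {G′ : HeapOn n} {w w′} →
                a ≡ a′ → G ≃ G′ → addBelow a G w ≃ addBelow a′ G′ w′
addBelow-cong {m} {n} {a} {G = G} {G′} refl I = record
  { to = to⁺ ; from = from⁺ ; to-from = to-from⁺ ; from-to = from-to⁺
  ; lab-to = lab-to⁺ ; to-mono = λ {x} {y} → mono⁺ x y ; to-reflect = λ {x} {y} → reflect⁺ x y }
  where
  open _≃_ I
  to⁺ : Fin (suc m) → Fin (suc n)
  to⁺ zero    = zero
  to⁺ (suc i) = suc (to i)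
  from⁺ : Fin (suc n) → Fin (suc m)
  from⁺ zero    = zero
  from⁺ (suc j) = suc (from j)
  to-from⁺ : ∀ y → to⁺ (from⁺ y) ≡ y
  to-from⁺ zero    = refl
  to-from⁺ (suc j) = cong suc (to-from j)
  from-to⁺ : ∀ x → from⁺ (to⁺ x) ≡ x
  from-to⁺ zero    = refl
  from-to⁺ (suc i) = cong suc (from-to i)
  lab-to⁺ : ∀ x → lab⁺ a G′ (to⁺ x) ≡ lab⁺ a G x
  lab-to⁺ zero    = refl
  lab-to⁺ (suc i) = lab-to i
  mono⁺ : ∀ x y → _≼⁺_ a G x y → _≼⁺_ a G′ (to⁺ x) (to⁺ y)
  mono⁺ zero    zero    _             = tt
  mono⁺ zero    (suc j) (i , c , i≼j) = to i , subst (Concurrent a) (sym (lab-to i)) c , to-mono i≼j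
  mono⁺ (suc i) (suc j) i≼j           = to-mono i≼j
  reflect⁺ : ∀ x y → _≼⁺_ a G′ (to⁺ x) (to⁺ y) → _≼⁺_ a G x y
  reflect⁺ zero    zero    _             = tt
  reflect⁺ zero    (suc j) (i , c , i≼j) =
    from i , subst (Concurrent a) (sym (lab-from i)) c ,
    to-reflect (subst (λ z → HeapOn._≼_ G′ z (to j)) (sym (to-from i)) i≼j)
  reflect⁺ (suc i) (suc j) i≼j           = to-reflect i≼j

addBelow-restrict : ∀ {m n a a′} {G : HeapOn m} {G′ : HeapOn n} {w w′} →
                    (I : addBelow a G w ≃ addBelow a′ G′ w′) → _≃_.to I zero ≡ zero → G ≃ G′
addBelow-restrict {m} {n} {a} {a′} {G} {G′} I to0≡0 = record
  { to = to⁻ ; from = from⁻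
  ; to-from = λ y →
      suc-injective (trans (suc-to⁻ (from⁻ y)) (trans (cong to (suc-from⁻ y)) (to-from (suc y))))
  ; from-to = λ x →
      suc-injective (trans (suc-from⁻ (to⁻ x)) (trans (cong from (suc-to⁻ x)) (from-to (suc x))))
  ; lab-to = λ x → trans (cong (lab⁺ a′ G′) (suc-to⁻ x)) (lab-to (suc x))
  ; to-mono = λ {x} {y} x≼y →
      subst₂ (_≼⁺_ a′ G′) (sym (suc-to⁻ x)) (sym (suc-to⁻ y)) (to-mono {suc x} {suc y} x≼y)
  ; to-reflect = λ {x} {y} x≼y →
      to-reflect {suc x} {suc y} (subst₂ (_≼⁺_ a′ G′) (suc-to⁻ x) (suc-to⁻ y) x≼y) }
  where
  open _≃_ I
  from0≡0 : from zero ≡ zero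
  from0≡0 = trans (cong from (sym to0≡0)) (from-to zero)
  0≢to : ∀ i → zero ≢ to (suc i)
  0≢to i 0≡to = case trans (sym from0≡0) (trans (cong from 0≡to) (from-to (suc i))) of λ ()
  0≢from : ∀ j → zero ≢ from (suc j)
  0≢from j 0≡from = case trans (sym to0≡0) (trans (cong to 0≡from) (to-from (suc j))) of λ ()
  to⁻ : Fin m → Fin n
  to⁻ i = punchOut (0≢to i)
  from⁻ : Fin n → Fin m
  from⁻ j = punchOut (0≢from j)
  suc-to⁻ : ∀ i → suc (to⁻ i) ≡ to (suc i)
  suc-to⁻ i = punchIn-punchOut (0≢to i)
  suc-from⁻ : ∀ j → suc (from⁻ j) ≡ from (suc j)
  suc-from⁻ j = punchIn-punchOut (0≢from j)

-- The heap of a canonical sequence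

mutual
  heapOf : ∀ p → Canonical p → HeapOn (length p)
  heapOf (t ∷ [])     t≤1          = singleton (piece t) (code≤1⇒left≡1 t≤1)
  heapOf (t ∷ t′ ∷ p) (t≤1+t′ , c) =
    addBelow (piece t) (heapOf (t′ ∷ p) c) (heapOf-meets t′ p c t≤1+t′)

  -- The codes drop by at most one per step and end at most 1, so one is within one of j.
  heapOf-meets : ∀ t p (c : Canonical (t ∷ p)) {j} → j ≤ suc t →
                 ∃ λ i → Concurrent (piece j) (HeapOn.lab (heapOf (t ∷ p) c) i)
  heapOf-meets t []       t≤1          j≤1+t = zero , piece-concurrent j≤1+t (≤-trans t≤1 (s≤s z≤n))
  heapOf-meets t (t′ ∷ p) (t≤1+t′ , c) {j} j≤1+t with t ≤? suc j
  ... | yes t≤1+j = zero , piece-concurrent j≤1+t t≤1+j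
  ... | no t≰1+j  = let i , meets = heapOf-meets t′ p c j≤1+t′ in suc i , meets
    where
    j≤1+t′ : j ≤ suc t′
    j≤1+t′ = m≤n⇒m≤1+n (<⇒≤ (s≤s⁻¹ (≤-trans (≰⇒> t≰1+j) t≤1+t′)))

heapOf-bottom-lab : ∀ t p (c : Canonical (t ∷ p)) → HeapOn.lab (heapOf (t ∷ p) c) zero ≡ piece t
heapOf-bottom-lab t []      _ = refl
heapOf-bottom-lab t (_ ∷ _) _ = refl

heapOf-bottom-minimal : ∀ t p (c : Canonical (t ∷ p)) → HeapOn.Minimal (heapOf (t ∷ p) c) zero
heapOf-bottom-minimal t []      _ y       _ = Fin1-all-zero y
heapOf-bottom-minimal t (_ ∷ _) _ zero    _ = refl

heapOf-bottom-least : ∀ t p (c : Canonical (t ∷ p)) y → HeapOn.Minimal (heapOf (t ∷ p) c) y →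
                      t ≤ code (HeapOn.lab (heapOf (t ∷ p) c) y)
heapOf-bottom-least t []       _            zero    _   = ≤-reflexive (sym (code-piece t))
heapOf-bottom-least t (t′ ∷ p) _            zero    _   = ≤-reflexive (sym (code-piece t))
heapOf-bottom-least t (t′ ∷ p) (t≤1+t′ , c) (suc j) min =
  ≮⇒≥ λ code<t → case min zero (j , meets code<t , ≼-refl) of λ ()
  where
  open HeapOn (heapOf (t′ ∷ p) c) using (lab; Minimal; isPO)
  open IsPartialOrder isPO using () renaming (refl to ≼-refl)
  min-j : Minimal j
  min-j z z≼j = suc-injective (min (suc z) z≼j)
  meets : code (lab j) < t → Concurrent (piece t) (lab j)
  meets code<t = subst (Concurrent (piece t)) (piece-code (lab j)) (piece-concurrent
    (≤-trans t≤1+t′ (s≤s (heapOf-bottom-least t′ p c j min-j))) (m≤n⇒m≤1+n (<⇒≤ code<t)))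

size-heapOf : ∀ p c → size (toHeap (heapOf p c)) ≡ weightSum p
size-heapOf (t ∷ [])     _       = refl
size-heapOf (t ∷ t′ ∷ p) (_ , c) = cong (weight (piece t) +_) (size-heapOf (t′ ∷ p) c)

heapOf-cong : ∀ {p p′ c c′} → p ≡ p′ → heapOf p c ≃ heapOf p′ c′
heapOf-cong {p} {c = c} {c′} refl rewrite canonical-irrelevant p c c′ = ≃-refl

heapOf-bottom-≃ : ∀ t p s q c c′ (I : heapOf (t ∷ p) c ≃ heapOf (s ∷ q) c′) →
                  t ≡ s × _≃_.to I zero ≡ zero
heapOf-bottom-≃ t p s q c c′ I = ≤-antisym t≤s s≤t , to0≡0
  where
  open _≃_ I
  min₀  = heapOf-bottom-minimal t p c
  min₀′ = heapOf-bottom-minimal s q c′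
  code-to0 : code (HeapOn.lab (heapOf (s ∷ q) c′) (to zero)) ≡ t
  code-to0 = trans (cong code (trans (lab-to zero) (heapOf-bottom-lab t p c))) (code-piece t)
  code-from0 : code (HeapOn.lab (heapOf (t ∷ p) c) (from zero)) ≡ s
  code-from0 = trans (cong code (trans (lab-from zero) (heapOf-bottom-lab s q c′))) (code-piece s)
  s≤t : s ≤ t
  s≤t = subst (s ≤_) code-to0 (heapOf-bottom-least s q c′ (to zero) (to-minimal min₀))
  t≤s : t ≤ s
  t≤s = subst (t ≤_) code-from0 (heapOf-bottom-least t p c (from zero) (from-minimal min₀′))
  same-lab : HeapOn.lab (heapOf (s ∷ q) c′) (to zero) ≡ HeapOn.lab (heapOf (s ∷ q) c′) zero
  same-lab = trans (trans (lab-to zero) (heapOf-bottom-lab t p c))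
                   (trans (cong piece (≤-antisym t≤s s≤t)) (sym (heapOf-bottom-lab s q c′)))
  to0≡0 : to zero ≡ zero
  to0≡0 = HeapOrder.minimal-concurrent⇒≡ (heapOf (s ∷ q) c′) (to-minimal min₀) min₀′
            (subst (Concurrent _) same-lab (concurrent-refl _))

heapOf-injective : ∀ p p′ c c′ → heapOf p c ≃ heapOf p′ c′ → p ≡ p′
heapOf-injective (t ∷ [])     (s ∷ [])     c c′ I = cong (_∷ []) (proj₁ (heapOf-bottom-≃ t [] s [] c c′ I))
heapOf-injective (t ∷ [])     (s ∷ s′ ∷ q) _ _  I = case ≃⇒≡ I of λ ()
heapOf-injective (t ∷ t′ ∷ p) (s ∷ [])     _ _  I = case ≃⇒≡ I of λ ()
heapOf-injective (t ∷ t′ ∷ p) (s ∷ s′ ∷ q) c@(_ , c₁) c′@(_ , c₁′) I =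
  let t≡s , to0≡0 = heapOf-bottom-≃ t (t′ ∷ p) s (s′ ∷ q) c c′ I
  in cong₂ _∷_ t≡s (heapOf-injective (t′ ∷ p) (s′ ∷ q) c₁ c₁′ (addBelow-restrict I to0≡0))

-- Normal forms

module ℕ-Sum = CommutativeMonoidSum +-0-commutativeMonoid

sumFin≡sum : ∀ k f → sumFin k f ≡ ℕ-Sum.sum f
sumFin≡sum zero    f = refl
sumFin≡sum (suc k) f = cong (f zero +_) (sumFin≡sum k (f ∘ suc))

sumFin-punchIn : ∀ {k} (f : Fin (suc k) → ℕ) x →
                 sumFin (suc k) f ≡ f x + sumFin k (f ∘ punchIn x)
sumFin-punchIn {k} f x = begin
  sumFin (suc k) f              ≡⟨ sumFin≡sum (suc k) f ⟩
  ℕ-Sum.sum f                       ≡⟨ ℕ-Sum.sum-remove f ⟩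
  f x + ℕ-Sum.sum (f ∘ punchIn x)   ≡⟨ cong (f x +_) (sym (sumFin≡sum k (f ∘ punchIn x))) ⟩
  f x + sumFin k (f ∘ punchIn x) ∎
  where open ≡-Reasoning

NormalForm : ∀ {m} → HeapOn m → Set
NormalForm G = ∃ λ p → Σ (Canonical p) λ c → G ≃ heapOf p c × size (toHeap G) ≡ weightSum p

module Removal {n} (G : HeapOn (suc n)) {x} (min-x : HeapOn.Minimal G x) (x≢top : x ≢ HeapOn.top G) where
  open HeapOn G
  open IsPartialOrder isPO using () renaming (refl to ≼-refl; trans to ≼-trans; antisym to ≼-antisym)
  open HeapOrder G using (_≼?_; first-step; ≼-top)

  ι : Fin n → Fin (suc n)
  ι = punchIn x

  ι-injective : ∀ {i j} → ι i ≡ ι j → i ≡ j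
  ι-injective = punchIn-injective x _ _

  ι≢x : ∀ j → ι j ≢ x
  ι≢x = punchInᵢ≢i x

  x-or-ι : ∀ z → (z ≡ x) ⊎ ∃ λ j → ι j ≡ z
  x-or-ι z with z ≟ x
  ... | yes z≡x = inj₁ z≡x
  ... | no z≢x  = inj₂ (punchOut (z≢x ∘ sym) , punchIn-punchOut (z≢x ∘ sym))

  ⋠x : ∀ j → ¬ ι j ≼ x
  ⋠x j ιj≼x = ι≢x j (min-x (ι j) ιj≼x)

  step-above : ∀ {y} → x ≼ y → x ≢ y → ∃ λ i → Concurrent (lab x) (lab (ι i)) × ι i ≼ y
  step-above x≼y x≢y with first-step (x≼y , x≢y)
  ... | c , (x-c , _ , x≢c) , c≼y with x-or-ι c
  ...   | inj₁ c≡x       = contradiction (sym c≡x) x≢c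
  ...   | inj₂ (i , refl) = i , x-c , c≼y

  top⁻ : Fin n
  top⁻ = punchOut x≢top

  ι-top⁻ : ι top⁻ ≡ top
  ι-top⁻ = punchIn-punchOut x≢top

  remove : HeapOn n
  remove = record
    { lab = lab ∘ ι
    ; _≼_ = λ i j → ι i ≼ ι j
    ; isPO = record
      { isPreorder = record
        { isEquivalence = isEquivalence ; reflexive = λ { refl → ≼-refl } ; trans = ≼-trans }
      ; antisym = λ ιi≼ιj ιj≼ιi → ι-injective (≼-antisym ιi≼ιj ιj≼ιi) }
    ; concurrent⇒comparable = λ i j → concurrent⇒comparable (ι i) (ι j)
    ; covering⇒concurrent = covering⁻
    ; top = top⁻
    ; top-max = λ y top≼y →
        ι-injective (trans (top-max (ι y) (subst (_≼ ι y) ι-top⁻ top≼y)) (sym ι-top⁻))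
    ; top-unique = λ m maximal →
        ι-injective (trans (top-unique (ι m) (maximal⁺ m maximal)) (sym ι-top⁻))
    ; top-left = trans (cong (left ∘ lab) ι-top⁻) top-left }
    where
    covering⁻ : ∀ i j → ι i ≼ ι j → i ≢ j → (∀ z → ι i ≼ ι z → ι z ≼ ι j → (z ≡ i) ⊎ (z ≡ j)) →
                Concurrent (lab (ι i)) (lab (ι j))
    covering⁻ i j ιi≼ιj i≢j covers =
      covering⇒concurrent (ι i) (ι j) ιi≼ιj (i≢j ∘ ι-injective) covers⁺
      where
      covers⁺ : ∀ z → ι i ≼ z → z ≼ ι j → (z ≡ ι i) ⊎ (z ≡ ι j)
      covers⁺ z ιi≼z z≼ιj with x-or-ι z
      ... | inj₁ refl         = contradiction ιi≼z (⋠x i)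
      ... | inj₂ (z′ , refl) with covers z′ ιi≼z z≼ιj
      ...   | inj₁ z′≡i = inj₁ (cong ι z′≡i)
      ...   | inj₂ z′≡j = inj₂ (cong ι z′≡j)
    maximal⁺ : ∀ m → (∀ y → ι m ≼ ι y → y ≡ m) → ∀ y → ι m ≼ y → y ≡ ι m
    maximal⁺ m maximal y ιm≼y with x-or-ι y
    ... | inj₁ refl        = contradiction ιm≼y (⋠x m)
    ... | inj₂ (y′ , refl) = cong ι (maximal y′ ιm≼y)

  witness : ∃ λ i → Concurrent (lab x) (lab (ι i))
  witness = let i , c , _ = step-above (≼-top x) x≢top in i , c

  addBelow-remove : addBelow (lab x) remove witness ≃ G
  addBelow-remove = record
    { to = to ; from = from ; to-from = to-from ; from-to = from-to
    ; lab-to = λ { zero → refl ; (suc j) → refl }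
    ; to-mono = λ {y} {z} → monotone y z ; to-reflect = λ {y} {z} → reflecting y z }
    where
    to : Fin (suc n) → Fin (suc n)
    to zero    = x
    to (suc j) = ι j
    from : Fin (suc n) → Fin (suc n)
    from z with x-or-ι z
    ... | inj₁ _       = zero
    ... | inj₂ (j , _) = suc j
    to-from : ∀ z → to (from z) ≡ z
    to-from z with x-or-ι z
    ... | inj₁ z≡x      = sym z≡x
    ... | inj₂ (j , ιj≡z) = ιj≡z
    from-to : ∀ y → from (to y) ≡ y
    from-to zero with x-or-ι x
    ... | inj₁ _          = refl
    ... | inj₂ (j , ιj≡x) = contradiction ιj≡x (ι≢x j)
    from-to (suc j) with x-or-ι (ι j)
    ... | inj₁ ιj≡x        = contradiction ιj≡x (ι≢x j)
    ... | inj₂ (j′ , ιj′≡ιj) = cong suc (ι-injective ιj′≡ιj)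
    monotone : ∀ y z → _≼⁺_ (lab x) remove y z → to y ≼ to z
    monotone zero    zero    _                 = ≼-refl
    monotone zero    (suc j) (i , c , ιi≼ιj) with concurrent⇒comparable x (ι i) c
    ... | inj₁ x≼ιi = ≼-trans x≼ιi ιi≼ιj
    ... | inj₂ ιi≼x = contradiction ιi≼x (⋠x i)
    monotone (suc i) (suc j) ιi≼ιj             = ιi≼ιj
    reflecting : ∀ y z → to y ≼ to z → _≼⁺_ (lab x) remove y z
    reflecting zero    zero    _     = tt
    reflecting zero    (suc j) x≼ιj  = step-above x≼ιj (ι≢x j ∘ sym)
    reflecting (suc i) zero    ιi≼x  = ⋠x i ιi≼x
    reflecting (suc i) (suc j) ιi≼ιj = ιi≼ιj

  size-remove : size (toHeap G) ≡ weight (lab x) + size (toHeap remove)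
  size-remove = sumFin-punchIn (weight ∘ lab) x

  module _ (least : ∀ y → Minimal y → code (lab x) ≤ code (lab y)) where

    -- Either ι y covers x, and then meets it, or ι y was already minimal in G.
    code-bound : ∀ y → HeapOn.Minimal remove y → code (lab x) ≤ suc (code (lab (ι y)))
    code-bound y min-y with x ≼? ι y
    ... | yes x≼ιy = concurrent⇒code≤ _ _ (covering⇒concurrent x (ι y) x≼ιy (ι≢x y ∘ sym) covers)
      where
      covers : ∀ z → x ≼ z → z ≼ ι y → (z ≡ x) ⊎ (z ≡ ι y)
      covers z x≼z z≼ιy with x-or-ι z
      ... | inj₁ z≡x         = inj₁ z≡x
      ... | inj₂ (z′ , refl) = inj₂ (cong ι (min-y z′ z≼ιy))
    ... | no x⋠ιy = m≤n⇒m≤1+n (least (ι y) min-ιy)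
      where
      min-ιy : Minimal (ι y)
      min-ιy z z≼ιy with x-or-ι z
      ... | inj₁ refl        = contradiction z≼ιy x⋠ιy
      ... | inj₂ (z′ , refl) = cong ι (min-y z′ z≼ιy)

    addBelow-normalForm : NormalForm remove → NormalForm G
    addBelow-normalForm (t ∷ q , c , J , size≡) =
      code (lab x) ∷ t ∷ q , (bound , c) ,
      ≃-trans (≃-sym addBelow-remove) (addBelow-cong (sym (piece-code (lab x))) J) ,
      trans size-remove (cong₂ _+_ (cong weight (sym (piece-code (lab x)))) size≡)
      where
      open _≃_ J using (from; lab-from; from-minimal)
      code-from0 : code (lab (ι (from zero))) ≡ t
      code-from0 = trans (cong code (trans (lab-from zero) (heapOf-bottom-lab t q c))) (code-piece t)
      bound : code (lab x) ≤ suc t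
      bound = subst (λ s → code (lab x) ≤ suc s) code-from0
                (code-bound (from zero) (from-minimal (heapOf-bottom-minimal t q c)))

minimal≢top : ∀ {n} (G : HeapOn (suc (suc n))) {x} → HeapOn.Minimal G x → x ≢ HeapOn.top G
minimal≢top G {x} min-x refl = punchInᵢ≢i x zero (min-x (punchIn x zero) (HeapOrder.≼-top G _))

normalForm : ∀ {m} (G : HeapOn m) → NormalForm G
normalForm {zero}        G = case HeapOn.top G of λ ()
normalForm {suc zero}    G =
  code (lab top) ∷ [] , left≡1⇒code≤1 _ top-left , I , cong (λ a → weight a + 0) (sym (lab-to zero))
  where
  open HeapOn G
  open IsPartialOrder isPO using () renaming (refl to ≼-refl)
  lab-to : ∀ x → piece (code (lab top)) ≡ lab x
  lab-to x = trans (piece-code (lab top)) (cong lab (trans (Fin1-all-zero top) (sym (Fin1-all-zero x))))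
  I : G ≃ heapOf (code (lab top) ∷ []) (left≡1⇒code≤1 _ top-left)
  I = record
    { to = λ x → x ; from = λ x → x ; to-from = λ _ → refl ; from-to = λ _ → refl
    ; lab-to = lab-to
    ; to-mono = λ _ → tt
    ; to-reflect = λ {x} {y} _ → subst (x ≼_) (trans (Fin1-all-zero x) (sym (Fin1-all-zero y))) ≼-refl }
normalForm {suc (suc n)} G =
  let x , min-x , least = HeapOrder.least-code-minimal G
      open Removal G min-x (minimal≢top G min-x)
  in addBelow-normalForm least (normalForm remove)

proposition7p3 : (n : ℕ) → n ≥ 1 →
    Σ (SymMatching n → HeapOfSize n) λ f →
      (∀ a b → proj₁ (f a) ≅ proj₁ (f b) → proj₁ a ≡ proj₁ b) ×
      (∀ (H : HeapOfSize n) → Σ (SymMatching n) λ a → proj₁ (f a) ≅ proj₁ H)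
proposition7p3 n n≥1 = heapOfMatching , injective , surjective
  where
  heapOfMatching : SymMatching n → HeapOfSize n
  heapOfMatching (w , m) =
    toHeap (heapOf (codesOf w) (codesOf-canonical m n≥1)) ,
    trans (size-heapOf (codesOf w) _) (weightSum-codesOf m)

  injective : ∀ a b → proj₁ (heapOfMatching a) ≅ proj₁ (heapOfMatching b) → proj₁ a ≡ proj₁ b
  injective (w , m) (w′ , m′) I = codesOf-injective m m′ (heapOf-injective _ _ _ _ (≅⇒≃ I))

  surjective : ∀ H → Σ (SymMatching n) λ a → proj₁ (heapOfMatching a) ≅ proj₁ H
  surjective (H , size≡n) =
    let p , c , I , size≡ = normalForm (fromHeap H)
        w , m , codes≡ = codesOf-surjective p c
    in (w , subst (λ k → IsSymMatching k w) (trans (sym size≡) size≡n) m) ,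
       ≃⇒≅ (≃-trans (heapOf-cong codes≡) (≃-sym I))
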